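{- Let $G_1,G_2$ be finite simple connected graphs, $G_1$ having $n_1$ vertices and $m_1$ edges, and let $\emptyset\neq U\subseteq V(G_2)$. Then the generalized hierarchical product satisfies \[F(G_1\Pi G_2(U))=|U|F(G_1)+n_1F(G_2)+3M_1(G_1)\sum_{v\in U}d_{G_2}(v)+6m_1\sum_{v\in U}d_{G_2}(v)^2.\]
   Context: The generalized hierarchical product $G_1\Pi G_2(U)$ has vertex set $V(G_1)\times V(G_2)$, with $(u,v)$ adjacent to $(u',v')$ iff [$u=u'$ and $vv'\in E(G_2)$] or [$v=v'\in U$ and $uu'\in E(G_1)$]. For a finite simple graph $G$ with vertex degrees $d_G(v)$: $M_1(G)=\sum_{v} d_G(v)^2$ and $F(G)=\sum_{v} d_G(v)^3$. -}

module Defs where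

open import Data.Nat using (ℕ; zero; suc; _+_; _*_; _^_; _<ᵇ_)
open import Data.Fin using (Fin; toℕ; remQuot; _≟_)
open import Data.Fin.Subset using (Subset; _∈_)
open import Data.Fin.Subset.Properties using (_∈?_)
open import Data.Bool using (Bool; true; false; _∧_; _∨_; if_then_else_)
open import Data.Bool.Properties using (∧-comm; ∨-comm)
open import Data.Product using (_×_; _,_; proj₁; proj₂)
open import Relation.Nullary.Decidable using (⌊_⌋; yes; no)
open import Relation.Binary.PropositionalEquality using (_≡_; refl; sym; cong; cong₂)

∑ : (n : ℕ) → (Fin n → ℕ) → ℕ
∑ zero    f = 0
∑ (suc n) f = f Fin.zero + ∑ n (λ i → f (Fin.suc i))

record SimpleGraph (n : ℕ) : Set where
  field
    adj    : Fin n → Fin n → Bool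
    symm   : ∀ i j → adj i j ≡ adj j i
    irrefl : ∀ i → adj i i ≡ false
open SimpleGraph public

data Walk {n : ℕ} (G : SimpleGraph n) : Fin n → Fin n → Set where
  nil  : ∀ {u} → Walk G u u
  cons : ∀ {u v w} → adj G u v ≡ true → Walk G v w → Walk G u w

Connected : ∀ {n} → SimpleGraph n → Set
Connected {n} G = ∀ (u v : Fin n) → Walk G u v

deg : ∀ {n} → SimpleGraph n → Fin n → ℕ
deg {n} G i = ∑ n (λ j → if adj G i j then 1 else 0)

edges : ∀ {n} → SimpleGraph n → ℕ
edges {n} G = ∑ n (λ i → ∑ n (λ j → if (toℕ i <ᵇ toℕ j) ∧ adj G i j then 1 else 0))

M₁ : ∀ {n} → SimpleGraph n → ℕ
M₁ {n} G = ∑ n (λ v → deg G v ^ 2)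

F : ∀ {n} → SimpleGraph n → ℕ
F {n} G = ∑ n (λ v → deg G v ^ 3)

-- Generalized hierarchical product G₁ Π G₂(U).  The vertex (u , v) of
-- V(G₁) × V(G₂) is encoded as the element of Fin (n₁ * n₂) whose
-- 'remQuot n₂' is (u , v) (i.e. Data.Fin.combine u v).
eqᵇ : ∀ {n} → Fin n → Fin n → Bool
eqᵇ x y = ⌊ x ≟ y ⌋

inᵇ : ∀ {n} → Fin n → Subset n → Bool
inᵇ v U = ⌊ v ∈? U ⌋

prodAdj : ∀ {n₁ n₂} → SimpleGraph n₁ → SimpleGraph n₂ → Subset n₂ →
          (Fin n₁ × Fin n₂) → (Fin n₁ × Fin n₂) → Bool
prodAdj G₁ G₂ U (u , v) (u' , v') =
  (eqᵇ u u' ∧ adj G₂ v v') ∨ (eqᵇ v v' ∧ inᵇ v U ∧ adj G₁ u u')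

private
  eqᵇ-sym : ∀ {n} (x y : Fin n) → eqᵇ x y ≡ eqᵇ y x
  eqᵇ-sym x y with x ≟ y | y ≟ x
  ... | yes _ | yes _ = refl
  ... | no _  | no _  = refl
  ... | yes p | no q  with q (sym p)
  ... | ()
  eqᵇ-sym x y | no q | yes p with q (sym p)
  ... | ()

  eqᵇ-refl : ∀ {n} (x : Fin n) → eqᵇ x x ≡ true
  eqᵇ-refl x with x ≟ x
  ... | yes _ = refl
  ... | no q with q refl
  ... | ()

  -- when x ≡ y is true, inᵇ x U ≡ inᵇ y U; handled by case split
  key : ∀ {n} (U : Subset n) (v v' : Fin n) → eqᵇ v v' ∧ inᵇ v U ≡ eqᵇ v' v ∧ inᵇ v' U
  key U v v' with v ≟ v' | v' ≟ v
  ... | yes refl | yes _ = refl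
  ... | no _  | no _  = refl
  ... | yes p | no q  with q (sym p)
  ... | ()
  key U v v' | no q | yes p with q (sym p)
  ... | ()

  ∧-assoc' : ∀ a b c → a ∧ b ∧ c ≡ (a ∧ b) ∧ c
  ∧-assoc' true b c = refl
  ∧-assoc' false b c = refl

  prodAdj-sym : ∀ {n₁ n₂} (G₁ : SimpleGraph n₁) (G₂ : SimpleGraph n₂) (U : Subset n₂)
                (p q : Fin n₁ × Fin n₂) → prodAdj G₁ G₂ U p q ≡ prodAdj G₁ G₂ U q p
  prodAdj-sym G₁ G₂ U (u , v) (u' , v')
    rewrite ∧-assoc' (eqᵇ v v') (inᵇ v U) (adj G₁ u u')
          | ∧-assoc' (eqᵇ v' v) (inᵇ v' U) (adj G₁ u' u)
          | key U v v' | eqᵇ-sym u u' | symm G₂ v v' | symm G₁ u u' = refl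

  prodAdj-irr : ∀ {n₁ n₂} (G₁ : SimpleGraph n₁) (G₂ : SimpleGraph n₂) (U : Subset n₂)
                (p : Fin n₁ × Fin n₂) → prodAdj G₁ G₂ U p p ≡ false
  prodAdj-irr G₁ G₂ U (u , v) rewrite eqᵇ-refl u | eqᵇ-refl v | irrefl G₂ v | irrefl G₁ u
    with inᵇ v U
  ... | true = refl
  ... | false = refl

hierProd : ∀ {n₁ n₂} → SimpleGraph n₁ → SimpleGraph n₂ → Subset n₂ →
           SimpleGraph (n₁ * n₂)
hierProd {n₁} {n₂} G₁ G₂ U = record
  { adj    = λ i j → prodAdj G₁ G₂ U (remQuot n₂ i) (remQuot n₂ j)
  ; symm   = λ i j → prodAdj-sym G₁ G₂ U (remQuot n₂ i) (remQuot n₂ j)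
  ; irrefl = λ i → prodAdj-irr G₁ G₂ U (remQuot n₂ i)
  }

module Submission where

-- Identify a vertex of the product with a pair (u , v) ∈ V(G₁) × V(G₂).
-- Its neighbours are the G₂-neighbours (u , v') together with, when v ∈ U,
-- the G₁-neighbours (u' , v); the two kinds never coincide, so
--   d(u , v) = d₂(v) + [v ∈ U] · d₁(u).
-- Cubing, with [v ∈ U]² = [v ∈ U], gives
--   d(u , v)³ = d₂(v)³ + [v ∈ U] (d₁(u)³ + 3 d₁(u)² d₂(v) + 3 d₁(u) d₂(v)²),
-- and summing over all pairs separates into products of sums over G₁ and
-- G₂: Σ_u d₁(u)³ = F(G₁), Σ_u d₁(u)² = M₁(G₁), Σ_u d₁(u) = 2 m₁
-- (handshake lemma) and Σ_v [v ∈ U] = |U|.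

open import Defs
open import Data.Nat using (ℕ; zero; suc; _+_; _*_; _^_; _<ᵇ_)
open import Data.Nat.Properties using (+-*-semiring; +-assoc; +-identityʳ; *-zeroʳ; *-comm; *-distribʳ-+)
open import Data.Nat.Tactic.RingSolver using (solve-∀)
open import Data.Fin as Fin using (Fin; toℕ; splitAt; remQuot)
open import Data.Fin.Properties using (toℕ-injective)
open import Data.Fin.Subset using (Subset; Nonempty; ∣_∣; inside; outside)
open import Data.Fin.Subset.Properties using (_∈?_)
open import Data.Bool using (Bool; true; false; _∧_; _∨_; T; if_then_else_)
open import Data.Bool.Properties using (∧-zeroʳ)
open import Data.Product using (_×_; _,_; proj₁; proj₂; swap; map₂)
open import Data.Sum using (_⊎_; inj₁; inj₂; [_,_]′; map₁)
open import Data.Vec using (_∷_; [])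
open import Relation.Nullary using (yes; no)
open import Data.Empty using (⊥-elim)
open import Relation.Nullary.Decidable using (⌊_⌋)
open import Relation.Binary.PropositionalEquality
  using (_≡_; _≢_; refl; sym; trans; cong; cong₂; module ≡-Reasoning)
import Algebra.Properties.Semiring.Sum as SemiringSum

open ≡-Reasoning
open SemiringSum +-*-semiring using (sum; ∑-distrib-+; ∑-comm; *-distribˡ-sum)

∑≡sum : ∀ n (f : Fin n → ℕ) → ∑ n f ≡ sum f
∑≡sum zero    f = refl
∑≡sum (suc n) f = cong (f Fin.zero +_) (∑≡sum n (λ i → f (Fin.suc i)))

∑-cong : ∀ n {f g : Fin n → ℕ} → (∀ i → f i ≡ g i) → ∑ n f ≡ ∑ n g
∑-cong zero    f≗g = refl
∑-cong (suc n) f≗g = cong₂ _+_ (f≗g Fin.zero) (∑-cong n (λ i → f≗g (Fin.suc i)))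

∑-+ : ∀ n (f g : Fin n → ℕ) → ∑ n (λ i → f i + g i) ≡ ∑ n f + ∑ n g
∑-+ n f g = begin
  ∑ n (λ i → f i + g i)  ≡⟨ ∑≡sum n _ ⟩
  sum (λ i → f i + g i)  ≡⟨ ∑-distrib-+ f g ⟩
  sum f + sum g          ≡⟨ sym (cong₂ _+_ (∑≡sum n f) (∑≡sum n g)) ⟩
  ∑ n f + ∑ n g          ∎

∑-*ˡ : ∀ n c (f : Fin n → ℕ) → ∑ n (λ i → c * f i) ≡ c * ∑ n f
∑-*ˡ n c f = begin
  ∑ n (λ i → c * f i)  ≡⟨ ∑≡sum n _ ⟩
  sum (λ i → c * f i)  ≡⟨ sym (*-distribˡ-sum c f) ⟩
  c * sum f            ≡⟨ sym (cong (c *_) (∑≡sum n f)) ⟩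
  c * ∑ n f            ∎

∑-swap : ∀ m n (f : Fin m → Fin n → ℕ) →
  ∑ m (λ i → ∑ n (f i)) ≡ ∑ n (λ j → ∑ m (λ i → f i j))
∑-swap m n f = begin
  ∑ m (λ i → ∑ n (f i))            ≡⟨ ∑-cong m (λ i → ∑≡sum n (f i)) ⟩
  ∑ m (λ i → sum (f i))            ≡⟨ ∑≡sum m _ ⟩
  sum (λ i → sum (f i))            ≡⟨ ∑-comm f ⟩
  sum (λ j → sum (λ i → f i j))    ≡⟨ sym (∑≡sum n _) ⟩
  ∑ n (λ j → sum (λ i → f i j))    ≡⟨ sym (∑-cong n (λ j → ∑≡sum m (λ i → f i j))) ⟩
  ∑ n (λ j → ∑ m (λ i → f i j))    ∎

∑-const : ∀ n c → ∑ n (λ _ → c) ≡ n * c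
∑-const zero    c = refl
∑-const (suc n) c = cong (c +_) (∑-const n c)

∑-separate : ∀ m n (f : Fin m → ℕ) (g : Fin n → ℕ) →
  ∑ m (λ i → ∑ n (λ j → f i * g j)) ≡ ∑ m f * ∑ n g
∑-separate m n f g = begin
  ∑ m (λ i → ∑ n (λ j → f i * g j))  ≡⟨ ∑-cong m (λ i → ∑-*ˡ n (f i) g) ⟩
  ∑ m (λ i → f i * ∑ n g)            ≡⟨ ∑-cong m (λ i → *-comm (f i) (∑ n g)) ⟩
  ∑ m (λ i → ∑ n g * f i)            ≡⟨ ∑-*ˡ m (∑ n g) f ⟩
  ∑ n g * ∑ m f                      ≡⟨ *-comm (∑ n g) (∑ m f) ⟩
  ∑ m f * ∑ n g                      ∎

∑-splitAt : ∀ m n (g : Fin m ⊎ Fin n → ℕ) →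
  ∑ (m + n) (λ i → g (splitAt m i)) ≡ ∑ m (λ i → g (inj₁ i)) + ∑ n (λ j → g (inj₂ j))
∑-splitAt zero    n g = refl
∑-splitAt (suc m) n g = begin
  g (inj₁ Fin.zero) + ∑ (m + n) (λ i → g (map₁ Fin.suc (splitAt m i)))
    ≡⟨ cong (g (inj₁ Fin.zero) +_) (∑-splitAt m n (λ s → g (map₁ Fin.suc s))) ⟩
  g (inj₁ Fin.zero) + (∑ m (λ i → g (inj₁ (Fin.suc i))) + ∑ n (λ j → g (inj₂ j)))
    ≡⟨ sym (+-assoc (g (inj₁ Fin.zero)) _ _) ⟩
  ∑ (suc m) (λ i → g (inj₁ i)) + ∑ n (λ j → g (inj₂ j)) ∎

∑-remQuot : ∀ m n (f : Fin m × Fin n → ℕ) →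
  ∑ (m * n) (λ i → f (remQuot n i)) ≡ ∑ m (λ u → ∑ n (λ v → f (u , v)))
∑-remQuot zero    n f = refl
∑-remQuot (suc m) n f = begin
  ∑ (n + m * n) (λ i → f (remQuot {suc m} n i))
    ≡⟨ ∑-splitAt n (m * n) (λ s → f (block s)) ⟩
  ∑ n (λ v → f (Fin.zero , v)) + ∑ (m * n) (λ i → f (Fin.suc (proj₁ (remQuot {m} n i)) , proj₂ (remQuot {m} n i)))
    ≡⟨ cong (∑ n (λ v → f (Fin.zero , v)) +_) (∑-remQuot m n (λ (u , v) → f (Fin.suc u , v))) ⟩
  ∑ (suc m) (λ u → ∑ n (λ v → f (u , v))) ∎
  where
  -- remQuot on Fin (n + m * n) is defined by cases on splitAt n.
  block : Fin n ⊎ Fin (m * n) → Fin (suc m) × Fin n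
  block s = swap ([ (λ v → v , Fin.zero) , (λ i → map₂ Fin.suc (Fin.quotRem {m} n i)) ]′ s)

∑²-+ : ∀ m n (f g : Fin m → Fin n → ℕ) →
  ∑ m (λ i → ∑ n (λ j → f i j + g i j)) ≡ ∑ m (λ i → ∑ n (f i)) + ∑ m (λ i → ∑ n (g i))
∑²-+ m n f g = trans (∑-cong m (λ i → ∑-+ n (f i) (g i))) (∑-+ m _ _)

-- A double sum of β(j) + Σₖ αₖ(i) xₖ(j) separates into products of single
-- sums; Σ d(u , v)³ takes this shape once each cube is expanded.
∑²-expand : ∀ m n (β : Fin n → ℕ) (α₁ α₂ α₃ : Fin m → ℕ) (x₁ x₂ x₃ : Fin n → ℕ) →
  ∑ m (λ i → ∑ n (λ j → β j + α₁ i * x₁ j + α₂ i * x₂ j + α₃ i * x₃ j))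
    ≡ m * ∑ n β + ∑ m α₁ * ∑ n x₁ + ∑ m α₂ * ∑ n x₂ + ∑ m α₃ * ∑ n x₃
∑²-expand m n β α₁ α₂ α₃ x₁ x₂ x₃ = begin
  ∑ m (λ i → ∑ n (λ j → β j + α₁ i * x₁ j + α₂ i * x₂ j + α₃ i * x₃ j))
    ≡⟨ ∑²-+ m n _ _ ⟩
  ∑ m (λ i → ∑ n (λ j → β j + α₁ i * x₁ j + α₂ i * x₂ j)) + ∑∑ α₃ x₃
    ≡⟨ cong (_+ ∑∑ α₃ x₃) (∑²-+ m n _ _) ⟩
  ∑ m (λ i → ∑ n (λ j → β j + α₁ i * x₁ j)) + ∑∑ α₂ x₂ + ∑∑ α₃ x₃
    ≡⟨ cong (λ s → s + ∑∑ α₂ x₂ + ∑∑ α₃ x₃) (∑²-+ m n _ _) ⟩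
  ∑ m (λ _ → ∑ n β) + ∑∑ α₁ x₁ + ∑∑ α₂ x₂ + ∑∑ α₃ x₃
    ≡⟨ cong₂ _+_ (cong₂ _+_ (cong₂ _+_ (∑-const m (∑ n β)) (∑-separate m n α₁ x₁))
                            (∑-separate m n α₂ x₂))
                 (∑-separate m n α₃ x₃) ⟩
  m * ∑ n β + ∑ m α₁ * ∑ n x₁ + ∑ m α₂ * ∑ n x₂ + ∑ m α₃ * ∑ n x₃ ∎
  where
  ∑∑ : (Fin m → ℕ) → (Fin n → ℕ) → ℕ
  ∑∑ α x = ∑ m (λ i → ∑ n (λ j → α i * x j))

χ : Bool → ℕ
χ b = if b then 1 else 0

χ-∧ : ∀ a b → χ (a ∧ b) ≡ χ a * χ b
χ-∧ true  b = sym (+-identityʳ (χ b))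
χ-∧ false b = refl

χ-∨-disjoint : ∀ a b → (T a → b ≡ false) → χ (a ∨ b) ≡ χ a + χ b
χ-∨-disjoint true  b a⇒¬b rewrite a⇒¬b _ = refl
χ-∨-disjoint false b a⇒¬b = refl

eqᵇ-suc : ∀ {n} (i j : Fin n) → eqᵇ (Fin.suc i) (Fin.suc j) ≡ eqᵇ i j
eqᵇ-suc i j with i Fin.≟ j
... | yes _ = refl
... | no  _ = refl

∑-δ : ∀ n (i : Fin n) c → ∑ n (λ j → χ (eqᵇ i j) * c) ≡ c
∑-δ (suc n) Fin.zero    c = begin
  (c + 0) + ∑ n (λ _ → 0)  ≡⟨ cong ((c + 0) +_) (trans (∑-const n 0) (*-zeroʳ n)) ⟩
  (c + 0) + 0              ≡⟨ trans (+-identityʳ (c + 0)) (+-identityʳ c) ⟩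
  c                        ∎
∑-δ (suc n) (Fin.suc i) c =
  trans (∑-cong n (λ j → cong (λ b → χ b * c) (eqᵇ-suc i j))) (∑-δ n i c)

<ᵇ-exactly-one : ∀ m n → m ≢ n → χ (m <ᵇ n) + χ (n <ᵇ m) ≡ 1
<ᵇ-exactly-one zero    zero    m≢n = ⊥-elim (m≢n refl)
<ᵇ-exactly-one zero    (suc n) m≢n = refl
<ᵇ-exactly-one (suc m) zero    m≢n = refl
<ᵇ-exactly-one (suc m) (suc n) m≢n = <ᵇ-exactly-one m n (λ m≡n → m≢n (cong suc m≡n))

module _ {n : ℕ} (G : SimpleGraph n) where

  oriented : Fin n → Fin n → ℕ
  oriented i j = χ ((toℕ i <ᵇ toℕ j) ∧ adj G i j)

  adj-oriented : ∀ i j → χ (adj G i j) ≡ oriented i j + oriented j i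
  adj-oriented i j with i Fin.≟ j
  ... | yes refl rewrite irrefl G i | ∧-zeroʳ (toℕ i <ᵇ toℕ i) = refl
  ... | no  i≢j = begin
    χ (adj G i j)
      ≡⟨ sym (+-identityʳ _) ⟩
    1 * χ (adj G i j)
      ≡⟨ cong (_* χ (adj G i j)) (sym (<ᵇ-exactly-one (toℕ i) (toℕ j) (λ eq → i≢j (toℕ-injective eq)))) ⟩
    (χ (toℕ i <ᵇ toℕ j) + χ (toℕ j <ᵇ toℕ i)) * χ (adj G i j)
      ≡⟨ *-distribʳ-+ (χ (adj G i j)) (χ (toℕ i <ᵇ toℕ j)) (χ (toℕ j <ᵇ toℕ i)) ⟩
    χ (toℕ i <ᵇ toℕ j) * χ (adj G i j) + χ (toℕ j <ᵇ toℕ i) * χ (adj G i j)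
      ≡⟨ cong₂ _+_ (sym (χ-∧ (toℕ i <ᵇ toℕ j) (adj G i j)))
                   (trans (cong (λ b → χ (toℕ j <ᵇ toℕ i) * χ b) (symm G i j))
                          (sym (χ-∧ (toℕ j <ᵇ toℕ i) (adj G j i)))) ⟩
    oriented i j + oriented j i ∎

  handshake : ∑ n (deg G) ≡ 2 * edges G
  handshake = begin
    ∑ n (λ i → ∑ n (λ j → χ (adj G i j)))
      ≡⟨ ∑-cong n (λ i → trans (∑-cong n (adj-oriented i)) (∑-+ n _ _)) ⟩
    ∑ n (λ i → ∑ n (oriented i) + ∑ n (λ j → oriented j i))
      ≡⟨ ∑-+ n _ _ ⟩
    edges G + ∑ n (λ i → ∑ n (λ j → oriented j i))
      ≡⟨ cong (edges G +_) (∑-swap n n (λ i j → oriented j i)) ⟩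
    edges G + edges G
      ≡⟨ cong (edges G +_) (sym (+-identityʳ (edges G))) ⟩
    2 * edges G ∎

inᵇ-suc : ∀ {n} (v : Fin n) (p : Subset n) s → inᵇ (Fin.suc v) (s ∷ p) ≡ inᵇ v p
inᵇ-suc v p s with v ∈? p
... | yes _ = refl
... | no  _ = refl

∣∣≡∑χ : ∀ {n} (U : Subset n) → ∣ U ∣ ≡ ∑ n (λ v → χ (inᵇ v U))
∣∣≡∑χ []            = refl
∣∣≡∑χ (inside ∷ p)  = cong suc (trans (∣∣≡∑χ p) (∑-cong _ (λ v → cong χ (sym (inᵇ-suc v p inside)))))
∣∣≡∑χ (outside ∷ p) = trans (∣∣≡∑χ p) (∑-cong _ (λ v → cong χ (sym (inᵇ-suc v p outside))))

-- The cube of b + [t] a, using [t]² = [t].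
cube-expansion : ∀ t a b →
  (b + χ t * a) ^ 3
    ≡ b ^ 3 + a ^ 3 * χ t + 3 * a ^ 2 * (if t then b else 0) + 3 * a * (if t then b ^ 2 else 0)
cube-expansion true  = binomial
  where
  -- Powers are spelled out as products: the ring solver does not read _^_.
  binomial : ∀ a b → (b + 1 * a) * ((b + 1 * a) * ((b + 1 * a) * 1))
                   ≡ b * (b * (b * 1)) + a * (a * (a * 1)) * 1 + 3 * (a * (a * 1)) * b + 3 * a * (b * (b * 1))
  binomial = solve-∀
cube-expansion false = trivial
  where
  trivial : ∀ a b → (b + 0 * a) * ((b + 0 * a) * ((b + 0 * a) * 1))
                  ≡ b * (b * (b * 1)) + a * (a * (a * 1)) * 0 + 3 * (a * (a * 1)) * 0 + 3 * a * 0
  trivial = solve-∀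

module _ {n₁ n₂ : ℕ} (G₁ : SimpleGraph n₁) (G₂ : SimpleGraph n₂) (U : Subset n₂) where

  -- The G₂-edges and the G₁-edges at a vertex never join the same pair,
  -- since a G₂-edge keeps the G₁-coordinate and G₁ has no loops.
  clauses-disjoint : ∀ u u' v v' → T (eqᵇ u u' ∧ adj G₂ v v') →
    (eqᵇ v v' ∧ inᵇ v U ∧ adj G₁ u u') ≡ false
  clauses-disjoint u u' v v' t with u Fin.≟ u'
  ... | yes refl rewrite irrefl G₁ u | ∧-zeroʳ (inᵇ v U) = ∧-zeroʳ (eqᵇ v v')

  adj-indicator : ∀ u u' v v' →
    χ (prodAdj G₁ G₂ U (u , v) (u' , v'))
      ≡ χ (eqᵇ u u') * χ (adj G₂ v v') + χ (eqᵇ v v') * (χ (inᵇ v U) * χ (adj G₁ u u'))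
  adj-indicator u u' v v' = begin
    χ (prodAdj G₁ G₂ U (u , v) (u' , v'))
      ≡⟨ χ-∨-disjoint (eqᵇ u u' ∧ adj G₂ v v') _ (clauses-disjoint u u' v v') ⟩
    χ (eqᵇ u u' ∧ adj G₂ v v') + χ (eqᵇ v v' ∧ inᵇ v U ∧ adj G₁ u u')
      ≡⟨ cong₂ _+_ (χ-∧ (eqᵇ u u') (adj G₂ v v'))
                   (trans (χ-∧ (eqᵇ v v') _) (cong (χ (eqᵇ v v') *_) (χ-∧ (inᵇ v U) (adj G₁ u u')))) ⟩
    χ (eqᵇ u u') * χ (adj G₂ v v') + χ (eqᵇ v v') * (χ (inᵇ v U) * χ (adj G₁ u u')) ∎

  deg-at : ∀ u v →
    ∑ (n₁ * n₂) (λ j → χ (prodAdj G₁ G₂ U (u , v) (remQuot n₂ j)))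
      ≡ deg G₂ v + χ (inᵇ v U) * deg G₁ u
  deg-at u v = begin
    ∑ (n₁ * n₂) (λ j → χ (prodAdj G₁ G₂ U (u , v) (remQuot n₂ j)))
      ≡⟨ ∑-remQuot n₁ n₂ (λ q → χ (prodAdj G₁ G₂ U (u , v) q)) ⟩
    ∑ n₁ (λ u' → ∑ n₂ (λ v' → χ (prodAdj G₁ G₂ U (u , v) (u' , v'))))
      ≡⟨ ∑-cong n₁ (λ u' → trans (∑-cong n₂ (adj-indicator u u' v)) (∑-+ n₂ _ _)) ⟩
    ∑ n₁ (λ u' → ∑ n₂ (λ v' → χ (eqᵇ u u') * χ (adj G₂ v v'))
               + ∑ n₂ (λ v' → χ (eqᵇ v v') * (χ (inᵇ v U) * χ (adj G₁ u u'))))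
      ≡⟨ ∑-cong n₁ (λ u' → cong₂ _+_ (∑-*ˡ n₂ (χ (eqᵇ u u')) _) (∑-δ n₂ v _)) ⟩
    ∑ n₁ (λ u' → χ (eqᵇ u u') * deg G₂ v + χ (inᵇ v U) * χ (adj G₁ u u'))
      ≡⟨ ∑-+ n₁ _ _ ⟩
    ∑ n₁ (λ u' → χ (eqᵇ u u') * deg G₂ v) + ∑ n₁ (λ u' → χ (inᵇ v U) * χ (adj G₁ u u'))
      ≡⟨ cong₂ _+_ (∑-δ n₁ u (deg G₂ v)) (∑-*ˡ n₁ (χ (inᵇ v U)) (λ u' → χ (adj G₁ u u'))) ⟩
    deg G₂ v + χ (inᵇ v U) * deg G₁ u ∎

  deg-hierProd : ∀ i → let (u , v) = remQuot {n₁} n₂ i in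
    deg (hierProd G₁ G₂ U) i ≡ deg G₂ v + χ (inᵇ v U) * deg G₁ u
  deg-hierProd i = deg-at (proj₁ (remQuot {n₁} n₂ i)) (proj₂ (remQuot {n₁} n₂ i))

-- Final regrouping of the terms, with Σ d₁ = 2 m₁ substituted.
regroup : ∀ n₁ F₁ F₂ M E k S₁ S₂ →
  n₁ * F₂ + F₁ * k + 3 * M * S₁ + 3 * (2 * E) * S₂
    ≡ k * F₁ + n₁ * F₂ + 3 * M * S₁ + 6 * E * S₂
regroup = solve-∀

theorem9 : ∀ {n₁ n₂ : ℕ} (G₁ : SimpleGraph n₁) (G₂ : SimpleGraph n₂) (U : Subset n₂) →
    Connected G₁ → Connected G₂ → Nonempty U →
    F (hierProd G₁ G₂ U)
      ≡ ∣ U ∣ * F G₁ + n₁ * F G₂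
        + 3 * M₁ G₁ * ∑ n₂ (λ v → if ⌊ v ∈? U ⌋ then deg G₂ v else 0)
        + 6 * edges G₁ * ∑ n₂ (λ v → if ⌊ v ∈? U ⌋ then deg G₂ v ^ 2 else 0)
theorem9 {n₁} {n₂} G₁ G₂ U _ _ _ = begin
  F (hierProd G₁ G₂ U)
    ≡⟨ ∑-cong (n₁ * n₂) (λ i → cong (_^ 3) (deg-hierProd G₁ G₂ U i)) ⟩
  ∑ (n₁ * n₂) (λ i → cubedDeg (remQuot n₂ i))
    ≡⟨ ∑-remQuot n₁ n₂ cubedDeg ⟩
  ∑ n₁ (λ u → ∑ n₂ (λ v → cubedDeg (u , v)))
    ≡⟨ ∑-cong n₁ (λ u → ∑-cong n₂ (λ v → cube-expansion (inᵇ v U) (deg G₁ u) (deg G₂ v))) ⟩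
  ∑ n₁ (λ u → ∑ n₂ (λ v → deg G₂ v ^ 3 + deg G₁ u ^ 3 * χ (inᵇ v U)
                          + 3 * deg G₁ u ^ 2 * Y₁ v + 3 * deg G₁ u * Y₂ v))
    ≡⟨ ∑²-expand n₁ n₂ (λ v → deg G₂ v ^ 3) (λ u → deg G₁ u ^ 3) (λ u → 3 * deg G₁ u ^ 2)
                 (λ u → 3 * deg G₁ u) (λ v → χ (inᵇ v U)) Y₁ Y₂ ⟩
  n₁ * F G₂ + F G₁ * ∑ n₂ (λ v → χ (inᵇ v U))
    + ∑ n₁ (λ u → 3 * deg G₁ u ^ 2) * ∑ n₂ Y₁ + ∑ n₁ (λ u → 3 * deg G₁ u) * ∑ n₂ Y₂
    ≡⟨ cong₂ (λ k d₁ → n₁ * F G₂ + F G₁ * k + ∑ n₁ (λ u → 3 * deg G₁ u ^ 2) * ∑ n₂ Y₁ + d₁ * ∑ n₂ Y₂)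
             (sym (∣∣≡∑χ U)) (trans (∑-*ˡ n₁ 3 (deg G₁)) (cong (3 *_) (handshake G₁))) ⟩
  n₁ * F G₂ + F G₁ * ∣ U ∣ + ∑ n₁ (λ u → 3 * deg G₁ u ^ 2) * ∑ n₂ Y₁ + 3 * (2 * edges G₁) * ∑ n₂ Y₂
    ≡⟨ cong (λ s → n₁ * F G₂ + F G₁ * ∣ U ∣ + s * ∑ n₂ Y₁ + 3 * (2 * edges G₁) * ∑ n₂ Y₂)
            (∑-*ˡ n₁ 3 (λ u → deg G₁ u ^ 2)) ⟩
  n₁ * F G₂ + F G₁ * ∣ U ∣ + 3 * M₁ G₁ * ∑ n₂ Y₁ + 3 * (2 * edges G₁) * ∑ n₂ Y₂
    ≡⟨ regroup n₁ (F G₁) (F G₂) (M₁ G₁) (edges G₁) ∣ U ∣ (∑ n₂ Y₁) (∑ n₂ Y₂) ⟩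
  ∣ U ∣ * F G₁ + n₁ * F G₂ + 3 * M₁ G₁ * ∑ n₂ Y₁ + 6 * edges G₁ * ∑ n₂ Y₂ ∎
  where
  cubedDeg : Fin n₁ × Fin n₂ → ℕ
  cubedDeg (u , v) = (deg G₂ v + χ (inᵇ v U) * deg G₁ u) ^ 3
  Y₁ Y₂ : Fin n₂ → ℕ
  Y₁ v = if inᵇ v U then deg G₂ v else 0
  Y₂ v = if inᵇ v U then deg G₂ v ^ 2 else 0
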